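{- Let $\Sigma\subseteq\mathcal L_\lozenge$ be closed under subformulas and let $\mathcal Q=(|\mathcal Q|,\preccurlyeq_\mathcal Q,S_\mathcal Q,\ell_\mathcal Q)$ be a weak $\Sigma$-quasimodel. Let $U\subseteq|\mathcal Q|$ be upward closed with respect to $\preccurlyeq_\mathcal Q$, and suppose that the relation $S_\mathcal Q\cap(U\times U)$ on $U$ is serial and $\omega$-sensible. Then the restriction $\mathcal Q\upharpoonright U=(U,\ \preccurlyeq_\mathcal Q\cap(U\times U),\ S_\mathcal Q\cap(U\times U),\ \ell_\mathcal Q\upharpoonright U)$ is a $\Sigma$-quasimodel.
   Context: $\mathcal L_\lozenge$ is the propositional language built from propositional variables and $\bot$ with $\wedge,\vee,\to$ and unary modalities $\bigcirc$ ("next") and $\lozenge$ ("eventually"). Types: for $\Sigma\subseteq\mathcal L_\lozenge$ closed under subformulas, a (two-sided) $\Sigma$-type is a pair $\Phi=(\Phi^-;\Phi^+)$ of subsets of $\Sigma$ with $\Phi^-\cap\Phi^+=\varnothing$, $\Phi^-\cup\Phi^+=\Sigma$, $\bot\notin\Phi^+$; for $\varphi\wedge\psi\in\Sigma$: $\varphi\wedge\psi\in\Phi^+$ iff $\varphi,\psi\in\Phi^+$; for $\varphi\vee\psi\in\Sigma$: $\varphi\vee\psi\in\Phi^+$ iff $\varphi\in\Phi^+$ or $\psi\in\Phi^+$; if $\varphi\to\psi\in\Phi^+$ then $\varphi\in\Phi^-$ or $\psi\in\Phi^+$; if $\lozenge\varphi\in\Phi^-$ then $\varphi\in\Phi^-$.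 Write $\Phi\preccurlyeq_T\Psi$ iff $\Phi^+\subseteq\Psi^+$. Define $\Phi\, S_T\,\Psi$ iff for all $\varphi$: $\bigcirc\varphi\in\Phi^+\Rightarrow\varphi\in\Psi^+$; $\bigcirc\varphi\in\Phi^-\Rightarrow\varphi\in\Psi^-$; ($\lozenge\varphi\in\Phi^+$ and $\varphi\in\Phi^-$) $\Rightarrow\lozenge\varphi\in\Psi^+$; $\lozenge\varphi\in\Phi^-\Rightarrow\lozenge\varphi\in\Psi^-$. A $\Sigma$-labelled frame is $(W,\preccurlyeq,\ell)$ with $\preccurlyeq$ a partial order on $W$ and $\ell$ mapping $W$ to $\Sigma$-types such that $w\preccurlyeq v$ implies $\ell(w)\preccurlyeq_T\ell(v)$, and whenever $\varphi\to\psi\in\ell^-(w)$ there is $v\succcurlyeq w$ with $\varphi\in\ell^+(v)$ and $\psi\in\ell^-(v)$. A weak $\Sigma$-quasimodel is $(W,\preccurlyeq,S,\ell)$ where $(W,\preccurlyeq,\ell)$ is a $\Sigma$-labelled frame and $S\subseteq W\times W$ is forward-confluent (if $w\preccurlyeq w'$ and $w\,S\,v$ then there is $v'\succcurlyeq v$ with $w'\,S\,v'$) and sensible ($w\,S\,v$ implies $\ell(w)\,S_T\,\ell(v)$). It is a $\Sigma$-quasimodel if moreover $S$ is serial (every $w$ has some $v$ with $w\,S\,v$) and $\omega$-sensible (whenever $\lozenge\varphi\in\ell^+(w)$ there are $n\ge0$ and $v$ with $w\,S^n\,v$ and $\varphi\in\ell^+(v)$). -}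

module Defs where

open import Data.Nat using (ℕ; zero; suc)
open import Data.Product using (Σ; _×_; _,_; proj₁; ∃; ∃-syntax)
open import Data.Sum using (_⊎_)
open import Data.Empty using (⊥)
open import Relation.Binary.PropositionalEquality using (_≡_)
open import Relation.Binary.Structures using (IsPartialOrder)
open import Level using (0ℓ)
open import Relation.Unary using (Pred)

infixr 6 _∧_
infixr 5 _∨_
infixr 4 _⇒_
data Form : Set where
  var  : ℕ → Form
  ⊥̇    : Form
  _∧_  : Form → Form → Form
  _∨_  : Form → Form → Form
  _⇒_  : Form → Form → Form
  ○    : Form → Form
  ◇    : Form → Form

FSet : Set₁
FSet = Pred Form 0ℓ

record SubformulaClosed (Sf : FSet) : Set where
  field
    ∧-cl : ∀ {φ ψ} → Sf (φ ∧ ψ) → Sf φ × Sf ψ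
    ∨-cl : ∀ {φ ψ} → Sf (φ ∨ ψ) → Sf φ × Sf ψ
    ⇒-cl : ∀ {φ ψ} → Sf (φ ⇒ ψ) → Sf φ × Sf ψ
    ○-cl : ∀ {φ} → Sf (○ φ) → Sf φ
    ◇-cl : ∀ {φ} → Sf (◇ φ) → Sf φ

record IsType (Sf : FSet) (neg pos : FSet) : Set where
  field
    neg⊆ : ∀ {φ} → neg φ → Sf φ
    pos⊆ : ∀ {φ} → pos φ → Sf φ
    disjoint : ∀ {φ} → neg φ → pos φ → ⊥
    cover : ∀ {φ} → Sf φ → neg φ ⊎ pos φ
    ⊥∉pos : pos ⊥̇ → ⊥
    ∧-intro : ∀ {φ ψ} → Sf (φ ∧ ψ) → pos φ → pos ψ → pos (φ ∧ ψ)
    ∧-elim  : ∀ {φ ψ} → pos (φ ∧ ψ) → pos φ × pos ψ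
    ∨-intro : ∀ {φ ψ} → Sf (φ ∨ ψ) → pos φ ⊎ pos ψ → pos (φ ∨ ψ)
    ∨-elim  : ∀ {φ ψ} → pos (φ ∨ ψ) → pos φ ⊎ pos ψ
    ⇒-pos   : ∀ {φ ψ} → pos (φ ⇒ ψ) → neg φ ⊎ pos ψ
    ◇-neg   : ∀ {φ} → neg (◇ φ) → neg φ

record Type (Sf : FSet) : Set₁ where
  field
    neg : FSet
    pos : FSet
    isType : IsType Sf neg pos
open Type public

_≼T_ : ∀ {Sf} → Type Sf → Type Sf → Set
Φ ≼T Ψ = ∀ {φ} → pos Φ φ → pos Ψ φ

record _Sᵀ_ {Sf : FSet} (Φ Ψ : Type Sf) : Set where
  field
    ○-pos : ∀ {φ} → pos Φ (○ φ) → pos Ψ φ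
    ○-neg : ∀ {φ} → neg Φ (○ φ) → neg Ψ φ
    ◇-pos : ∀ {φ} → pos Φ (◇ φ) → neg Φ φ → pos Ψ (◇ φ)
    ◇-neg : ∀ {φ} → neg Φ (◇ φ) → neg Ψ (◇ φ)

-- Σ-labelled frames.  The carrier W comes with its equality _≈_
-- (propositional equality for an ordinary set).
record IsLabelledFrame {Sf : FSet} (W : Set) (_≈_ _≼_ : W → W → Set)
                       (ℓ : W → Type Sf) : Set₁ where
  field
    isPartialOrder : IsPartialOrder _≈_ _≼_
    mono : ∀ {w v} → w ≼ v → ℓ w ≼T ℓ v
    ⇒-witness : ∀ {w φ ψ} → neg (ℓ w) (φ ⇒ ψ) →
                ∃[ v ] (w ≼ v × pos (ℓ v) φ × neg (ℓ v) ψ)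

ForwardConfluent : {W : Set} (_≼_ S : W → W → Set) → Set
ForwardConfluent {W} _≼_ S =
  ∀ {w w' v} → w ≼ w' → S w v → ∃[ v' ] (v ≼ v' × S w' v')

Sensible : ∀ {Sf} {W : Set} (S : W → W → Set) (ℓ : W → Type Sf) → Set
Sensible S ℓ = ∀ {w v} → S w v → ℓ w Sᵀ ℓ v

Serial : {W : Set} (S : W → W → Set) → Set
Serial {W} S = ∀ (w : W) → ∃[ v ] S w v

Iter : {W : Set} (S : W → W → Set) → ℕ → W → W → Set
Iter S zero    w v = w ≡ v
Iter S (suc n) w v = ∃[ u ] (S w u × Iter S n u v)

OmegaSensible : ∀ {Sf} {W : Set} (S : W → W → Set) (ℓ : W → Type Sf) → Set
OmegaSensible {W = W} S ℓ =
  ∀ {w : W} {φ} → pos (ℓ w) (◇ φ) → ∃[ n ] ∃[ v ] (Iter S n w v × pos (ℓ v) φ)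

record IsWeakQuasimodel {Sf : FSet} (W : Set) (_≈_ _≼_ S : W → W → Set)
                        (ℓ : W → Type Sf) : Set₁ where
  field
    isLabelledFrame : IsLabelledFrame W _≈_ _≼_ ℓ
    forwardConfluent : ForwardConfluent _≼_ S
    sensible : Sensible S ℓ

record IsQuasimodel {Sf : FSet} (W : Set) (_≈_ _≼_ S : W → W → Set)
                    (ℓ : W → Type Sf) : Set₁ where
  field
    isWeakQuasimodel : IsWeakQuasimodel W _≈_ _≼_ S ℓ
    serial : Serial S
    omegaSensible : OmegaSensible S ℓ

-- Restriction to a subset U ⊆ W (carrier Σ W U, elements of U compared
-- by equality in W).
Restrict : {W : Set} (U : W → Set) (R : W → W → Set) → Σ W U → Σ W U → Set
Restrict U R (w , _) (v , _) = R w v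

UpwardClosed : {W : Set} (_≼_ : W → W → Set) (U : W → Set) → Set
UpwardClosed _≼_ U = ∀ {w v} → w ≼ v → U w → U v

module Submission where

open import Defs
open import Data.Product using (Σ; proj₁; _,_)
open import Function using (_∘_)
open import Relation.Binary.PropositionalEquality using (_≡_)
open import Relation.Binary.Structures using (IsPartialOrder; IsEquivalence)

module _ {W : Set} (U : W → Set) where

  Restrict-isEquivalence : ∀ {_≈_ : W → W → Set} →
    IsEquivalence _≈_ → IsEquivalence (Restrict U _≈_)
  Restrict-isEquivalence eq = record
    { refl = E.refl ; sym = E.sym ; trans = E.trans }
    where module E = IsEquivalence eq

  Restrict-isPartialOrder : ∀ {_≈_ _≼_ : W → W → Set} →
    IsPartialOrder _≈_ _≼_ → IsPartialOrder (Restrict U _≈_) (Restrict U _≼_)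
  Restrict-isPartialOrder po = record
    { isPreorder = record
      { isEquivalence = Restrict-isEquivalence P.isEquivalence
      ; reflexive = P.reflexive
      ; trans = P.trans
      }
    ; antisym = P.antisym
    }
    where module P = IsPartialOrder po

  module _ {_≼_ : W → W → Set} (up : UpwardClosed _≼_ U) where

    Restrict-isLabelledFrame : ∀ {Sf} {_≈_ : W → W → Set} {ℓ : W → Type Sf} →
      IsLabelledFrame W _≈_ _≼_ ℓ →
      IsLabelledFrame (Σ W U) (Restrict U _≈_) (Restrict U _≼_) (ℓ ∘ proj₁)
    Restrict-isLabelledFrame lf = record
      { isPartialOrder = Restrict-isPartialOrder LF.isPartialOrder
      ; mono = LF.mono
      ; ⇒-witness = λ { {w , uw} n →
          let v , w≼v , φ⁺ , ψ⁻ = LF.⇒-witness n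
          in (v , up w≼v uw) , w≼v , φ⁺ , ψ⁻ }
      }
      where module LF = IsLabelledFrame lf

    Restrict-forwardConfluent : ∀ {S : W → W → Set} →
      ForwardConfluent _≼_ S → ForwardConfluent (Restrict U _≼_) (Restrict U S)
    Restrict-forwardConfluent fc {v = v , uv} w≼w' wSv =
      let v' , v≼v' , w'Sv' = fc w≼w' wSv
      in (v' , up v≼v' uv) , v≼v' , w'Sv'

    Restrict-isWeakQuasimodel : ∀ {Sf} {_≈_ S : W → W → Set} {ℓ : W → Type Sf} →
      IsWeakQuasimodel W _≈_ _≼_ S ℓ →
      IsWeakQuasimodel (Σ W U) (Restrict U _≈_) (Restrict U _≼_) (Restrict U S) (ℓ ∘ proj₁)
    -- The points of forwardConfluent are passed explicitly: Restrict computes by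
    -- matching on them, so they cannot be recovered by unification.
    Restrict-isWeakQuasimodel wq = record
      { isLabelledFrame = Restrict-isLabelledFrame Q.isLabelledFrame
      ; forwardConfluent = λ {w} {w'} {v} → Restrict-forwardConfluent Q.forwardConfluent {w} {w'} {v}
      ; sensible = Q.sensible
      }
      where module Q = IsWeakQuasimodel wq

lemma3p6 : (Sf : FSet) → SubformulaClosed Sf →
    (W : Set) (_≼_ S : W → W → Set) (ℓ : W → Type Sf) →
    IsWeakQuasimodel W _≡_ _≼_ S ℓ →
    (U : W → Set) → UpwardClosed _≼_ U →
    Serial (Restrict U S) →
    OmegaSensible (Restrict U S) (ℓ ∘ proj₁) →
    IsQuasimodel (Σ W U) (Restrict U _≡_) (Restrict U _≼_) (Restrict U S) (ℓ ∘ proj₁)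
lemma3p6 Sf _ W _≼_ S ℓ wq U up serial omegaSensible = record
  { isWeakQuasimodel = Restrict-isWeakQuasimodel U up wq
  ; serial = serial
  ; omegaSensible = omegaSensible
  }
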